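{- Any derivation in $\mathrm{LJ}$ extended with 2-systems can be transformed into a derivation of the same end-sequent (in the same calculus) with the following property: two applications of a top rule belonging to the same 2-system instance never occur on the same path of the derivation.
   Context: $\mathrm{LJ}$ is the propositional intuitionistic sequent calculus (sequents $\Gamma\Rightarrow\Pi$ with $\Gamma$ a multiset and $\Pi$ at most one formula, including internal weakening and contraction). A 2-system is a set of sequent rules $\{(r_1),\dots,(r_k),(r_B)\}$ used only as follows: the bottom rule $(r_B)$ infers $\Gamma\Rightarrow\Pi$ from $k$ premisses all equal to $\Gamma\Rightarrow\Pi$, where the derivation $\mathcal D_i$ of the $i$-th premiss may contain (possibly several) applications of the top rule $(r_i)$, which infers $\Sigma_0,\Gamma'\Rightarrow\Pi'$ from $\Sigma_1,\Gamma'\Rightarrow\Pi',\dots,\Sigma_n,\Gamma'\Rightarrow\Pi'$, all applications of top rules of the instance acting on the same multisets $\Sigma_0,\dots,\Sigma_n$. A 2-system instance is one application of a bottom rule together with the top rule applications it discharges. -}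

module Defs where

open import Data.Nat using (ℕ)
open import Data.Fin using (Fin; suc)
open import Data.List using (List; []; _∷_; _++_; length; lookup)
open import Data.Maybe using (Maybe; just; nothing)
open import Data.Product using (Σ; _×_; _,_; proj₁; proj₂)
open import Data.Sum using (_⊎_)
open import Data.Empty using (⊥)
open import Data.Unit using (⊤)
open import Relation.Nullary using (¬_)
open import Relation.Binary.PropositionalEquality using (_≡_)
open import Data.List.Relation.Binary.Permutation.Propositional using (_↭_)

data Fml : Set where
  atom : ℕ → Fml
  falsum : Fml
  _∧'_ _∨'_ _⊃_ : Fml → Fml → Fml

-- Sequents Γ ⇒ Π; Γ a list read up to permutation (exchange rule below),
-- Π at most one formula.
record Sequent : Set where
  constructor _⇒_
  field
    ant : List Fml
    succ : Maybe Fml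

-- A top rule: infers Σ₀,Γ' ⇒ Π' from Σ₁,Γ' ⇒ Π', …, Σₙ,Γ' ⇒ Π'.
-- Inst σ₀ σs says that (Σ₀; Σ₁,…,Σₙ) is an admissible instance of the rule
-- (e.g. an instantiation of its schematic variables).
record TopRule : Set₁ where
  field
    arity : ℕ
    Inst  : List Fml → (Fin arity → List Fml) → Set

InstOf : TopRule → Set
InstOf r = Σ (List Fml) λ σ₀ → Σ (Fin (TopRule.arity r) → List Fml) λ σs → TopRule.Inst r σ₀ σs

-- A 2-system {(r₁),…,(r_k),(r_B)}; the bottom rule is determined by k.
record TwoSystem : Set₁ where
  field
    k   : ℕ
    top : Fin k → TopRule

module Calculus {I : Set} (sys : I → TwoSystem) where

  open TwoSystem

  -- An open top rule of a 2-system instance: system s, rule index i,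
  -- and the multisets Σ₀,…,Σₙ fixed for all its applications.
  Token : Set
  Token = Σ I λ s → Σ (Fin (k (sys s))) λ i → InstOf (top (sys s) i)

  tArity : Token → ℕ
  tArity (s , i , _) = TopRule.arity (top (sys s) i)

  tΣ₀ : Token → List Fml
  tΣ₀ (_ , _ , σ₀ , _ , _) = σ₀

  tΣ : (t : Token) → Fin (tArity t) → List Fml
  tΣ (_ , _ , _ , σs , _) = σs

  -- Der E S : derivations of S in LJ + 2-systems, in which the top rules
  -- listed in E (discharged by enclosing bottom-rule applications) may be used.
  -- An entry of E is referenced by its position, so each position identifies
  -- one 2-system instance.
  data Der (E : List Token) : Sequent → Set where
    ax    : ∀ A → Der E ((A ∷ []) ⇒ just A)
    botL  : Der E ((falsum ∷ []) ⇒ nothing)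
    exch  : ∀ {Γ Δ Π} → Γ ↭ Δ → Der E (Γ ⇒ Π) → Der E (Δ ⇒ Π)
    wL    : ∀ {Γ Π} A → Der E (Γ ⇒ Π) → Der E ((A ∷ Γ) ⇒ Π)
    wR    : ∀ {Γ} A → Der E (Γ ⇒ nothing) → Der E (Γ ⇒ just A)
    cL    : ∀ {Γ Π} A → Der E ((A ∷ A ∷ Γ) ⇒ Π) → Der E ((A ∷ Γ) ⇒ Π)
    ∧L₁   : ∀ {Γ Π A} B → Der E ((A ∷ Γ) ⇒ Π) → Der E (((A ∧' B) ∷ Γ) ⇒ Π)
    ∧L₂   : ∀ {Γ Π B} A → Der E ((B ∷ Γ) ⇒ Π) → Der E (((A ∧' B) ∷ Γ) ⇒ Π)
    ∧R    : ∀ {Γ A B} → Der E (Γ ⇒ just A) → Der E (Γ ⇒ just B) → Der E (Γ ⇒ just (A ∧' B))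
    ∨L    : ∀ {Γ Π A B} → Der E ((A ∷ Γ) ⇒ Π) → Der E ((B ∷ Γ) ⇒ Π) → Der E (((A ∨' B) ∷ Γ) ⇒ Π)
    ∨R₁   : ∀ {Γ A} B → Der E (Γ ⇒ just A) → Der E (Γ ⇒ just (A ∨' B))
    ∨R₂   : ∀ {Γ B} A → Der E (Γ ⇒ just B) → Der E (Γ ⇒ just (A ∨' B))
    ⊃L    : ∀ {Γ Δ Π A B} → Der E (Γ ⇒ just A) → Der E ((B ∷ Δ) ⇒ Π) → Der E (((A ⊃ B) ∷ Γ ++ Δ) ⇒ Π)
    ⊃R    : ∀ {Γ A B} → Der E ((A ∷ Γ) ⇒ just B) → Der E (Γ ⇒ just (A ⊃ B))
    cut   : ∀ {Γ Δ Π} A → Der E (Γ ⇒ just A) → Der E ((A ∷ Δ) ⇒ Π) → Der E ((Γ ++ Δ) ⇒ Π)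
    topR  : (x : Fin (length E)) (Γ : List Fml) (Π : Maybe Fml)
          → ((j : Fin (tArity (lookup E x))) → Der E ((tΣ (lookup E x) j ++ Γ) ⇒ Π))
          → Der E ((tΣ₀ (lookup E x) ++ Γ) ⇒ Π)
    -- application of the bottom rule of 2-system s, opening a new instance:
    -- the i-th premiss may use the top rule rᵢ with the chosen Σ's.
    botR  : ∀ {Γ Π} (s : I) (insts : (i : Fin (k (sys s))) → InstOf (top (sys s) i))
          → ((i : Fin (k (sys s))) → Der ((s , i , insts i) ∷ E) (Γ ⇒ Π))
          → Der E (Γ ⇒ Π)

  Uses : ∀ {E S} → Der E S → Fin (length E) → Set
  Uses (ax _) x = ⊥
  Uses botL x = ⊥
  Uses (exch _ d) x = Uses d x
  Uses (wL _ d) x = Uses d x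
  Uses (wR _ d) x = Uses d x
  Uses (cL _ d) x = Uses d x
  Uses (∧L₁ _ d) x = Uses d x
  Uses (∧L₂ _ d) x = Uses d x
  Uses (∧R d e) x = Uses d x ⊎ Uses e x
  Uses (∨L d e) x = Uses d x ⊎ Uses e x
  Uses (∨R₁ _ d) x = Uses d x
  Uses (∨R₂ _ d) x = Uses d x
  Uses (⊃L d e) x = Uses d x ⊎ Uses e x
  Uses (⊃R d) x = Uses d x
  Uses (cut _ d e) x = Uses d x ⊎ Uses e x
  Uses (topR y Γ Π ds) x = (y ≡ x) ⊎ Σ (Fin _) λ j → Uses (ds j) x
  Uses (botR s insts ds) x = Σ (Fin _) λ i → Uses (ds i) (suc x)

  Separated : ∀ {E S} → Der E S → Set
  Separated (ax _) = ⊤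
  Separated botL = ⊤
  Separated (exch _ d) = Separated d
  Separated (wL _ d) = Separated d
  Separated (wR _ d) = Separated d
  Separated (cL _ d) = Separated d
  Separated (∧L₁ _ d) = Separated d
  Separated (∧L₂ _ d) = Separated d
  Separated (∧R d e) = Separated d × Separated e
  Separated (∨L d e) = Separated d × Separated e
  Separated (∨R₁ _ d) = Separated d
  Separated (∨R₂ _ d) = Separated d
  Separated (⊃L d e) = Separated d × Separated e
  Separated (⊃R d) = Separated d
  Separated (cut _ d e) = Separated d × Separated e
  Separated (topR x Γ Π ds) = ∀ j → (¬ Uses (ds j) x) × Separated (ds j)
  Separated (botR s insts ds) = ∀ i → Separated (ds i)

module Submission where

-- Each application of a top rule is replaced by one whose premisses are
-- plain LJ derivations.  For an instance with multisets Σ₀; Σ₁,…,Σₙ put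
-- D = ⋀Σ₁ ∨ … ∨ ⋀Σₙ.  Every Σⱼ ⇒ D is derivable in plain LJ, so the top
-- rule (with empty context) yields Σ₀ ⇒ D with no further top rule above
-- it.  The original premisses Σⱼ,Γ ⇒ Π, transformed recursively, give
-- D,Γ ⇒ Π by conjunction- and disjunction-left rules, and a cut on D
-- gives Σ₀,Γ ⇒ Π.  Bottom rules and LJ rules are kept.

open import Defs
open import Data.Nat using (ℕ; zero; suc)
open import Data.Fin using (Fin; zero; suc)
open import Data.List using (List; []; _∷_; _++_; length; lookup)
open import Data.List.Properties using (++-identityʳ)
open import Data.Maybe using (just; nothing)
open import Data.Product using (Σ; _×_; _,_; proj₁; proj₂; map; zip)
open import Data.Sum using ([_,_])
open import Data.Empty using (⊥)
open import Data.Unit using (⊤; tt)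
open import Function using (id)
open import Relation.Nullary using (¬_)
open import Relation.Binary.PropositionalEquality using (sym; cong)
open import Data.List.Relation.Binary.Permutation.Propositional
  using (_↭_; ↭-reflexive; ↭-refl; ↭-sym; swap)
open import Data.List.Relation.Binary.Permutation.Propositional.Properties
  using (shift)

module Separation {I : Set} (sys : I → TwoSystem) where
  open Calculus sys

  Plain : ∀ {E S} → Der E S → Set
  Plain (ax _) = ⊤
  Plain botL = ⊤
  Plain (exch _ d) = Plain d
  Plain (wL _ d) = Plain d
  Plain (wR _ d) = Plain d
  Plain (cL _ d) = Plain d
  Plain (∧L₁ _ d) = Plain d
  Plain (∧L₂ _ d) = Plain d
  Plain (∧R d e) = Plain d × Plain e
  Plain (∨L d e) = Plain d × Plain e
  Plain (∨R₁ _ d) = Plain d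
  Plain (∨R₂ _ d) = Plain d
  Plain (⊃L d e) = Plain d × Plain e
  Plain (⊃R d) = Plain d
  Plain (cut _ d e) = Plain d × Plain e
  Plain (topR _ _ _ _) = ⊥
  Plain (botR _ _ _) = ⊥

  PlainDer : List Token → Sequent → Set
  PlainDer E S = Σ (Der E S) Plain

  SepDer : List Token → Sequent → Set
  SepDer E S = Σ (Der E S) Separated

  plain⇒unused : ∀ {E S} (d : Der E S) → Plain d → ∀ x → ¬ Uses d x
  plain⇒unused (ax _) _ _ ()
  plain⇒unused botL _ _ ()
  plain⇒unused (exch _ d) p = plain⇒unused d p
  plain⇒unused (wL _ d) p = plain⇒unused d p
  plain⇒unused (wR _ d) p = plain⇒unused d p
  plain⇒unused (cL _ d) p = plain⇒unused d p
  plain⇒unused (∧L₁ _ d) p = plain⇒unused d p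
  plain⇒unused (∧L₂ _ d) p = plain⇒unused d p
  plain⇒unused (∧R d e) (p , q) x = [ plain⇒unused d p x , plain⇒unused e q x ]
  plain⇒unused (∨L d e) (p , q) x = [ plain⇒unused d p x , plain⇒unused e q x ]
  plain⇒unused (∨R₁ _ d) p = plain⇒unused d p
  plain⇒unused (∨R₂ _ d) p = plain⇒unused d p
  plain⇒unused (⊃L d e) (p , q) x = [ plain⇒unused d p x , plain⇒unused e q x ]
  plain⇒unused (⊃R d) p = plain⇒unused d p
  plain⇒unused (cut _ d e) (p , q) x = [ plain⇒unused d p x , plain⇒unused e q x ]

  plain⇒separated : ∀ {E S} (d : Der E S) → Plain d → Separated d
  plain⇒separated (ax _) _ = tt
  plain⇒separated botL _ = tt
  plain⇒separated (exch _ d) p = plain⇒separated d p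
  plain⇒separated (wL _ d) p = plain⇒separated d p
  plain⇒separated (wR _ d) p = plain⇒separated d p
  plain⇒separated (cL _ d) p = plain⇒separated d p
  plain⇒separated (∧L₁ _ d) p = plain⇒separated d p
  plain⇒separated (∧L₂ _ d) p = plain⇒separated d p
  plain⇒separated (∧R d e) (p , q) = plain⇒separated d p , plain⇒separated e q
  plain⇒separated (∨L d e) (p , q) = plain⇒separated d p , plain⇒separated e q
  plain⇒separated (∨R₁ _ d) p = plain⇒separated d p
  plain⇒separated (∨R₂ _ d) p = plain⇒separated d p
  plain⇒separated (⊃L d e) (p , q) = plain⇒separated d p , plain⇒separated e q
  plain⇒separated (⊃R d) p = plain⇒separated d p
  plain⇒separated (cut _ d e) (p , q) = plain⇒separated d p , plain⇒separated e q

  verum : Fml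
  verum = falsum ⊃ falsum

  ⋀ : List Fml → Fml
  ⋀ [] = verum
  ⋀ (A ∷ Γ) = A ∧' ⋀ Γ

  ⋁ : (n : ℕ) → (Fin n → Fml) → Fml
  ⋁ zero f = falsum
  ⋁ (suc n) f = f zero ∨' ⋁ n (λ j → f (suc j))

  assumption : ∀ {E} A Γ → PlainDer E ((A ∷ Γ) ⇒ just A)
  assumption A [] = ax A , tt
  assumption A (B ∷ Γ) = map (λ d → exch (swap B A ↭-refl) (wL B d)) id (assumption A Γ)

  ⋀-right : ∀ {E} Γ → PlainDer E (Γ ⇒ just (⋀ Γ))
  ⋀-right [] = ⊃R (ax falsum) , tt
  ⋀-right (A ∷ Γ) = zip (λ d e → ∧R d (wL A e)) _,_ (assumption A Γ) (⋀-right Γ)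

  ⋁-right : ∀ {E Γ} n (f : Fin n → Fml) (j : Fin n)
          → PlainDer E (Γ ⇒ just (f j)) → PlainDer E (Γ ⇒ just (⋁ n f))
  ⋁-right (suc n) f zero = map (∨R₁ _) id
  ⋁-right (suc n) f (suc j) d = map (∨R₂ _) id (⋁-right n (λ j → f (suc j)) j d)

  -- Σⱼ ⇒ ⋁ₖ ⋀Σₖ in plain LJ (context written Σⱼ ++ [] to match the top rule).
  member⇒⋁⋀ : ∀ {E} n (Σs : Fin n → List Fml) (j : Fin n)
             → PlainDer E ((Σs j ++ []) ⇒ just (⋁ n (λ k → ⋀ (Σs k))))
  member⇒⋁⋀ n Σs j =
    map (exch (↭-reflexive (sym (++-identityʳ (Σs j))))) id
        (⋁-right n (λ k → ⋀ (Σs k)) j (⋀-right (Σs j)))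

  falsum-left : ∀ {E} Γ Π → SepDer E ((falsum ∷ Γ) ⇒ Π)
  falsum-left [] nothing = botL , tt
  falsum-left [] (just A) = wR A botL , tt
  falsum-left (B ∷ Γ) Π = map (λ d → exch (swap B falsum ↭-refl) (wL B d)) id (falsum-left Γ Π)

  ⋀-left : ∀ {E} Σ' Γ Π → SepDer E ((Σ' ++ Γ) ⇒ Π) → SepDer E ((⋀ Σ' ∷ Γ) ⇒ Π)
  ⋀-left [] Γ Π = map (wL verum) id
  ⋀-left (A ∷ Σ') Γ Π d =
    map split id (⋀-left Σ' (A ∷ Γ) Π (map (exch (↭-sym (shift A Σ' Γ))) id d))
    where
      -- A ∧ ⋀Σ' is duplicated and each copy is projected to one conjunct.
      split : Der _ ((⋀ Σ' ∷ A ∷ Γ) ⇒ Π) → Der _ (((A ∧' ⋀ Σ') ∷ Γ) ⇒ Π)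
      split e = cL (A ∧' ⋀ Σ')
                   (∧L₁ (⋀ Σ') (exch (swap (A ∧' ⋀ Σ') A ↭-refl) (∧L₂ A e)))

  ⋁-left : ∀ {E} n (f : Fin n → Fml) Γ Π
         → ((j : Fin n) → SepDer E ((f j ∷ Γ) ⇒ Π)) → SepDer E ((⋁ n f ∷ Γ) ⇒ Π)
  ⋁-left zero f Γ Π ds = falsum-left Γ Π
  ⋁-left (suc n) f Γ Π ds =
    zip ∨L _,_ (ds zero) (⋁-left n (λ j → f (suc j)) Γ Π (λ j → ds (suc j)))

  separated-topR : ∀ {E} (x : Fin (length E)) Γ Π
                 → ((j : Fin (tArity (lookup E x))) → SepDer E ((tΣ (lookup E x) j ++ Γ) ⇒ Π))
                 → SepDer E ((tΣ₀ (lookup E x) ++ Γ) ⇒ Π)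
  separated-topR {E} x Γ Π ds =
    zip (λ t b → exch context (cut D t b)) _,_ (top , top-separated) body
    where
      n = tArity (lookup E x)
      Σs = tΣ (lookup E x)
      Σ₀ = tΣ₀ (lookup E x)
      D = ⋁ n (λ k → ⋀ (Σs k))

      premiss : (j : Fin n) → PlainDer E ((Σs j ++ []) ⇒ just D)
      premiss = member⇒⋁⋀ n Σs

      top : Der E ((Σ₀ ++ []) ⇒ just D)
      top = topR x [] (just D) (λ j → proj₁ (premiss j))

      top-separated : Separated top
      top-separated j = plain⇒unused (proj₁ (premiss j)) (proj₂ (premiss j)) x
                      , plain⇒separated (proj₁ (premiss j)) (proj₂ (premiss j))

      body : SepDer E ((D ∷ Γ) ⇒ Π)
      body = ⋁-left n (λ k → ⋀ (Σs k)) Γ Π (λ j → ⋀-left (Σs j) Γ Π (ds j))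

      context : ((Σ₀ ++ []) ++ Γ) ↭ (Σ₀ ++ Γ)
      context = ↭-reflexive (cong (_++ Γ) (++-identityʳ Σ₀))

  separate : ∀ {E S} → Der E S → SepDer E S
  separate (ax A) = ax A , tt
  separate botL = botL , tt
  separate (exch p d) = map (exch p) id (separate d)
  separate (wL A d) = map (wL A) id (separate d)
  separate (wR A d) = map (wR A) id (separate d)
  separate (cL A d) = map (cL A) id (separate d)
  separate (∧L₁ B d) = map (∧L₁ B) id (separate d)
  separate (∧L₂ A d) = map (∧L₂ A) id (separate d)
  separate (∧R d e) = zip ∧R _,_ (separate d) (separate e)
  separate (∨L d e) = zip ∨L _,_ (separate d) (separate e)
  separate (∨R₁ B d) = map (∨R₁ B) id (separate d)
  separate (∨R₂ A d) = map (∨R₂ A) id (separate d)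
  separate (⊃L d e) = zip ⊃L _,_ (separate d) (separate e)
  separate (⊃R d) = map ⊃R id (separate d)
  separate (cut A d e) = zip (cut A) _,_ (separate d) (separate e)
  separate (topR x Γ Π ds) = separated-topR x Γ Π (λ j → separate (ds j))
  separate (botR s insts ds) =
    botR s insts (λ i → proj₁ (separate (ds i))) , (λ i → proj₂ (separate (ds i)))

lemma1 : {I : Set} (sys : I → TwoSystem) (S : Sequent)
       → Calculus.Der sys [] S
       → Σ (Calculus.Der sys [] S) (λ d → Calculus.Separated sys d)
lemma1 sys S = Separation.separate sys
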